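{- Let $A$ be a $\tau$-structure, $C(A)$ its coarsest coherent $\sigma$-configuration, $R\in\sigma$, and $\mathcal{S}$ the set of strongly connected components of $R(C(A))$. Fix $E\in\tau$. Let $V,W,V',W'\in\mathcal{S}$ be such that there exist $v'\in V'$, $v\in V$ with $(v',v)\in E(A)$, and $(w',w)\notin E(A)$ for all $w'\in W'$, $w\in W$. Let $z\in V$, $z'\in V'$ be arbitrary and let $T\in\sigma$ with $(z',z)\in T(C(A))$. Then $T(C(A))\cap(W'\times W)=\emptyset$.
   Context: Structures are finite with only binary relations. A coherent $\sigma$-configuration is a $\sigma$-structure whose relations partition $V^2$, each inside or disjoint from the diagonal, closed under converses, with well-defined intersection numbers (for all $R_1,R_2,R_3\in\sigma$ the number of $w$ with $(u,w)\in R_2$, $(w,v)\in R_3$ is the same for all $(u,v)\in R_1$). $C(A)$ is the coarsest coherent configuration refining $A$ (each of its relations contained in or disjoint from each relation of $A$). Strongly connected components of a relation $R$ are inclusion-maximal sets $S$ such that for all $u,v\in S$ there is an $R$-path of length at least $1$ from $u$ to $v$. -}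

module Defs where

open import Data.Nat using (ℕ; zero; suc; _+_)
open import Data.Bool using (Bool; true; false; _∧_)
open import Data.Fin using (Fin)
open import Data.List using (List; allFin)
open import Data.Fin.Subset using (Subset; _∈_; _⊆_)
open import Data.Product using (Σ; _×_; _,_; ∃)
open import Data.Sum using (_⊎_)
open import Relation.Binary.PropositionalEquality using (_≡_)
open import Relation.Binary.Construct.Closure.Transitive using (TransClosure)
open import Relation.Nullary using (¬_)

Structure : Set → ℕ → Set
Structure ρ n = ρ → Fin n → Fin n → Bool

countL : {A : Set} → (A → Bool) → List A → ℕ
countL p List.[] = 0
countL p (x List.∷ xs) with p x
... | true  = suc (countL p xs)
... | false = countL p xs

count : {n : ℕ} → (Fin n → Bool) → ℕ
count {n} p = countL p (allFin n)

record IsCoherent {ρ : Set} {n : ℕ} (C : Structure ρ n) : Set where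
  field
    cover     : ∀ u v → Σ ρ λ R → C R u v ≡ true
    disjoint  : ∀ R R' u v → C R u v ≡ true → C R' u v ≡ true → R ≡ R'
    nonempty  : ∀ R → Σ (Fin n) λ u → Σ (Fin n) λ v → C R u v ≡ true
    diagonal  : ∀ R → (∀ u v → C R u v ≡ true → u ≡ v) ⊎ (∀ u → C R u u ≡ false)
    converse  : ∀ R → Σ ρ λ R' → ∀ u v → C R' u v ≡ C R v u
    intersection : ∀ R₁ R₂ R₃ u v u' v' → C R₁ u v ≡ true → C R₁ u' v' ≡ true →
      count (λ w → C R₂ u w ∧ C R₃ w v) ≡ count (λ w → C R₂ u' w ∧ C R₃ w v')

Refines : {ρ ρ' : Set} {n : ℕ} → Structure ρ n → Structure ρ' n → Set
Refines {ρ} {ρ'} {n} B A = ∀ (S : ρ) (R : ρ') →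
  (∀ u v → B S u v ≡ true → A R u v ≡ true) ⊎ (∀ u v → B S u v ≡ true → A R u v ≡ false)

record IsCoarsestCoherent {τ σ : Set} {n : ℕ} (A : Structure τ n) (C : Structure σ n) : Set₁ where
  field
    coherent : IsCoherent C
    refines  : Refines C A
    coarsest : ∀ {ρ : Set} (D : Structure ρ n) → IsCoherent D → Refines D A → Refines D C


Edge : {n : ℕ} → (Fin n → Fin n → Bool) → Fin n → Fin n → Set
Edge R u v = R u v ≡ true

StronglyConnected : {n : ℕ} → (Fin n → Fin n → Bool) → Subset n → Set
StronglyConnected R S = ∀ u v → u ∈ S → v ∈ S → TransClosure (Edge R) u v

IsSCC : {n : ℕ} → (Fin n → Fin n → Bool) → Subset n → Set
IsSCC {n} R S = StronglyConnected R S ×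
  (∀ (S' : Subset n) → StronglyConnected R S' → S ⊆ S' → S' ⊆ S)

{-# OPTIONS --safe #-}
-- Colours of a coherent configuration are "path-transitive": if (z', z) has colour T and
-- z' → v' → v → z is a path of colours B₁ B₃ B₄, then every T-coloured pair (x, y) starts
-- a path x → a → b → y with the same colours.  Since C(A) refines A, B₃ ⊆ E, so (a, b) ∈ E.
-- Reachability along R only depends on the colour of a pair, hence x and a (resp. b and y)
-- lie in a common strongly connected component of R, i.e. a ∈ W' and b ∈ W, contradicting
-- the absence of E-edges from W' to W.
module Submission where

open import Defs
open import Data.Nat using (ℕ)
open import Data.Bool using (Bool; true; false; _∧_)
open import Data.Bool.Properties using (¬-not)
open import Data.Fin using (Fin)
open import Data.Fin.Subset using (Subset; _∈_; _∪_; ⁅_⁆)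
open import Data.Fin.Subset.Properties using (x∈p∪q⁻; x∈p∪q⁺; x∈⁅x⁆; x∈⁅y⁆⇒x≡y)
open import Data.Product using (Σ; ∃; _×_; _,_; proj₁; proj₂)
open import Data.Sum using (inj₁; inj₂)
open import Data.List using (List; _∷_; allFin)
open import Data.List.Membership.Propositional using () renaming (_∈_ to _∈ₗ_)
open import Data.List.Membership.Propositional.Properties using (∈-allFin)
open import Data.List.Relation.Unary.Any using (here; there)
open import Function using (case_of_)
open import Relation.Binary.PropositionalEquality using (_≡_; _≢_; refl; sym; trans)
open import Relation.Binary.Construct.Closure.Transitive using (TransClosure; [_]; _∷_; _++_)

∧≡true : ∀ {a b} → a ∧ b ≡ true → a ≡ true × b ≡ true
∧≡true {true} {true} refl = refl , refl

true∧true : ∀ {a b} → a ≡ true → b ≡ true → a ∧ b ≡ true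
true∧true refl refl = refl

countL-≢0 : {A : Set} (p : A → Bool) {xs : List A} {w : A} → w ∈ₗ xs → p w ≡ true → countL p xs ≢ 0
countL-≢0 p {x ∷ _} (here refl) px with p x | px
... | true | _ = λ ()
countL-≢0 p {x ∷ _} (there w∈xs) pw with p x
... | true  = λ ()
... | false = countL-≢0 p w∈xs pw

countL-≢0⇒∃ : {A : Set} (p : A → Bool) (xs : List A) → countL p xs ≢ 0 → ∃ λ w → p w ≡ true
countL-≢0⇒∃ p List.[] ≢0 with () ← ≢0 refl
countL-≢0⇒∃ p (x ∷ xs) ≢0 with p x in px
... | true  = x , px
... | false = countL-≢0⇒∃ p xs ≢0

Refines-contained : {ρ ρ' : Set} {n : ℕ} {B : Structure ρ n} {A : Structure ρ' n} →
  Refines B A → ∀ {S R u v u' v'} →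
  B S u v ≡ true → A R u v ≡ true → B S u' v' ≡ true → A R u' v' ≡ true
Refines-contained ref {S} {R} {u} {v} Suv Ruv Su'v' with ref S R
... | inj₁ S⊆R = S⊆R _ _ Su'v'
... | inj₂ S∩R=∅ with () ← trans (sym (S∩R=∅ u v Suv)) Ruv

module Coherent {n : ℕ} {σ : Set} {C : Structure σ n} (coh : IsCoherent C) where
  open IsCoherent coh

  colour : Fin n → Fin n → σ
  colour u v = proj₁ (cover u v)

  colour-spec : ∀ u v → C (colour u v) u v ≡ true
  colour-spec u v = proj₂ (cover u v)

  lift-path₂ : ∀ {T B₁ B₂ u v w x y} → C T u v ≡ true → C B₁ u w ≡ true → C B₂ w v ≡ true →
    C T x y ≡ true → ∃ λ a → C B₁ x a ≡ true × C B₂ a y ≡ true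
  lift-path₂ {T} {B₁} {B₂} {u} {v} {w} {x} {y} Tuv B₁uw B₂wv Txy =
    let (a , B₁B₂xay) = countL-≢0⇒∃ (λ a → C B₁ x a ∧ C B₂ a y) (allFin n)
          (λ count≡0 → countL-≢0 (λ w → C B₁ u w ∧ C B₂ w v) (∈-allFin w) (true∧true B₁uw B₂wv)
                         (trans (intersection T B₁ B₂ u v x y Tuv Txy) count≡0))
    in a , ∧≡true B₁B₂xay

  lift-path₃ : ∀ {T B₁ B₂ B₃ u v w₁ w₂ x y} → C T u v ≡ true →
    C B₁ u w₁ ≡ true → C B₂ w₁ w₂ ≡ true → C B₃ w₂ v ≡ true → C T x y ≡ true →
    ∃ λ a → ∃ λ b → C B₁ x a ≡ true × C B₂ a b ≡ true × C B₃ b y ≡ true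
  lift-path₃ {u = u} {v} {w₁} {w₂} Tuv B₁uw₁ B₂w₁w₂ B₃w₂v Txy =
    let (a , B₁xa , Pay) = lift-path₂ Tuv B₁uw₁ (colour-spec w₁ v) Txy
        (b , B₂ab , B₃by) = lift-path₂ (colour-spec w₁ v) B₂w₁w₂ B₃w₂v Pay
    in a , b , B₁xa , B₂ab , B₃by

  module _ (R : σ) where
    Reach : Fin n → Fin n → Set
    Reach = TransClosure (Edge (C R))

    Reach-colour-invariant : ∀ {B a b a' b'} → C B a b ≡ true → C B a' b' ≡ true →
      Reach a b → Reach a' b'
    Reach-colour-invariant {B} {a} {b} Bab Ba'b' [ Rab ] with disjoint B R a b Bab Rab
    ... | refl = [ Ba'b' ]
    Reach-colour-invariant {B} {a} {b} Bab Ba'b' (_∷_ {y = p} Rap p⇝b) =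
      let (q , Ra'q , Pqb') = lift-path₂ Bab Rap (colour-spec p b) Ba'b'
      in Ra'q ∷ Reach-colour-invariant (colour-spec p b) Pqb' p⇝b

    MutuallyReach : Fin n → Fin n → Set
    MutuallyReach a b = Reach a b × Reach b a

    MutuallyReach-colour-invariant : ∀ {B a b a' b'} → C B a b ≡ true → C B a' b' ≡ true →
      MutuallyReach a b → MutuallyReach a' b'
    MutuallyReach-colour-invariant {B} {a} {b} {a'} {b'} Bab Ba'b' (a⇝b , b⇝a) =
      let (B˘ , B˘≡B) = converse B
      in Reach-colour-invariant Bab Ba'b' a⇝b
       , Reach-colour-invariant (trans (B˘≡B b a) Bab) (trans (B˘≡B b' a') Ba'b') b⇝a

IsSCC-mutuallyReach : {n : ℕ} {R : Fin n → Fin n → Bool} {S : Subset n} → IsSCC R S →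
  ∀ {u v} → u ∈ S → v ∈ S → TransClosure (Edge R) u v × TransClosure (Edge R) v u
IsSCC-mutuallyReach (sc , _) u∈S v∈S = sc _ _ u∈S v∈S , sc _ _ v∈S u∈S

IsSCC-closed : {n : ℕ} {R : Fin n → Fin n → Bool} {S : Subset n} → IsSCC R S →
  ∀ {x a} → x ∈ S → TransClosure (Edge R) x a → TransClosure (Edge R) a x → a ∈ S
IsSCC-closed {R = R} {S} (sc , maximal) {x} {a} x∈S x⇝a a⇝x =
  maximal (S ∪ ⁅ a ⁆) sc' (λ u∈S → x∈p∪q⁺ (inj₁ u∈S)) (x∈p∪q⁺ (inj₂ (x∈⁅x⁆ a)))
  where
  to-x : ∀ {u} → u ∈ S ∪ ⁅ a ⁆ → TransClosure (Edge R) u x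
  to-x u∈ with x∈p∪q⁻ S ⁅ a ⁆ u∈
  ... | inj₁ u∈S = sc _ x u∈S x∈S
  ... | inj₂ u∈⁅a⁆ with refl ← x∈⁅y⁆⇒x≡y a u∈⁅a⁆ = a⇝x
  from-x : ∀ {v} → v ∈ S ∪ ⁅ a ⁆ → TransClosure (Edge R) x v
  from-x v∈ with x∈p∪q⁻ S ⁅ a ⁆ v∈
  ... | inj₁ v∈S = sc x _ x∈S v∈S
  ... | inj₂ v∈⁅a⁆ with refl ← x∈⁅y⁆⇒x≡y a v∈⁅a⁆ = x⇝a
  sc' : StronglyConnected R (S ∪ ⁅ a ⁆)
  sc' u v u∈ v∈ = to-x u∈ ++ from-x v∈

lemma24 : {n : ℕ} {τ σ : Set} (A : Structure τ n) (C : Structure σ n) →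
    IsCoarsestCoherent A C →
    (R : σ) (E : τ) (V W V' W' : Subset n) →
    IsSCC (C R) V → IsSCC (C R) W → IsSCC (C R) V' → IsSCC (C R) W' →
    (Σ (Fin n) λ v' → Σ (Fin n) λ v → v' ∈ V' × v ∈ V × A E v' v ≡ true) →
    (∀ w' w → w' ∈ W' → w ∈ W → A E w' w ≡ false) →
    (z z' : Fin n) → z ∈ V → z' ∈ V' → (T : σ) → C T z' z ≡ true →
    ∀ x y → x ∈ W' → y ∈ W → C T x y ≡ false
lemma24 A C cc R E V W V' W' V-scc W-scc V'-scc W'-scc (v' , v , v'∈V' , v∈V , Ev'v) noE
  z z' z∈V z'∈V' T Tz'z x y x∈W' y∈W = ¬-not no-T-edge
  where
  open IsCoarsestCoherent cc
  open Coherent coherent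

  no-T-edge : C T x y ≢ true
  no-T-edge Txy
    with a , b , B₁xa , B₃ab , B₄by ←
         lift-path₃ Tz'z (colour-spec z' v') (colour-spec v' v) (colour-spec v z) Txy
    = case trans (sym Eab) (noE a b a∈W' b∈W) of λ ()
    where
    Eab : A E a b ≡ true
    Eab = Refines-contained refines (colour-spec v' v) Ev'v B₃ab

    x⇔a : MutuallyReach R x a
    x⇔a = MutuallyReach-colour-invariant R (colour-spec z' v') B₁xa
            (IsSCC-mutuallyReach V'-scc z'∈V' v'∈V')

    b⇔y : MutuallyReach R b y
    b⇔y = MutuallyReach-colour-invariant R (colour-spec v z) B₄by
            (IsSCC-mutuallyReach V-scc v∈V z∈V)

    a∈W' : a ∈ W'
    a∈W' = IsSCC-closed W'-scc x∈W' (proj₁ x⇔a) (proj₂ x⇔a)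

    b∈W : b ∈ W
    b∈W = IsSCC-closed W-scc y∈W (proj₂ b⇔y) (proj₁ b⇔y)
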